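{- Any randomized one-pass streaming algorithm that solves the correlation clustering problem (i.e. outputs an optimal clustering) with probability greater than $\frac{2}{3}$ requires $\Omega(n^2)$ bits of memory, where $n$ is the number of vertices.
   Context: Correlation clustering: the input is a complete graph on $n$ vertices in which every edge is labeled $+$ or $-$; the labeled edges arrive one by one in a stream in arbitrary order. The goal is a partition of the vertices into clusters minimizing the number of $+$ edges between different clusters plus the number of $-$ edges inside clusters. -}

module Defs where

open import Data.Nat using (ℕ; zero; suc; _+_; _*_; _≤_; _<_; _<ᵇ_)
open import Data.Bool using (Bool; true; false; if_then_else_)
open import Data.Fin using (Fin; toℕ; _≟_)
open import Data.Fin.Subset using (Subset; _∈_; ∣_∣)
open import Data.List using (List; []; _∷_; [_]; concatMap; map; allFin)
open import Data.Nat.ListAction using (sum)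
open import Data.List.Relation.Binary.Permutation.Propositional using (_↭_)
open import Data.Product using (_×_; _,_; Σ; ∃)
open import Data.Vec using (Vec; foldl)
open import Relation.Nullary using (does)

-- A signed complete graph on vertex set Fin n: a label for each pair i < j
-- (true = "+" edge, false = "-" edge).  Only the values on i < j are used.
Labeling : ℕ → Set
Labeling n = Fin n → Fin n → Bool

allPairs : (n : ℕ) → List (Fin n × Fin n)
allPairs n = concatMap (λ i → concatMap (λ j →
               if toℕ i <ᵇ toℕ j then [ (i , j) ] else []) (allFin n)) (allFin n)

-- A clustering assigns each vertex a cluster name; two vertices are in the
-- same cluster iff they get the same name.
Clustering : ℕ → Set
Clustering n = Fin n → Fin n

disagree : ∀ {n} → Labeling n → Clustering n → Fin n × Fin n → ℕ
disagree L C (i , j) with L i j | does (C i ≟ C j)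
... | true  | true  = 0
... | true  | false = 1
... | false | true  = 1
... | false | false = 0

cost : ∀ {n} → Labeling n → Clustering n → ℕ
cost {n} L C = sum (map (disagree L C) (allPairs n))

Optimal : ∀ {n} → Labeling n → Clustering n → Set
Optimal L C = ∀ C' → cost L C ≤ cost L C'

Edge : ℕ → Set
Edge n = Fin n × Fin n × Bool

stream : ∀ {n} → Labeling n → List (Fin n × Fin n) → List (Edge n)
stream L σ = map (λ { (i , j) → (i , j , L i j) }) σ

-- A randomized one-pass streaming algorithm on n vertices using s bits of
-- memory, with random seed drawn uniformly from Fin m.  Memory state = Vec Bool s.
record StreamAlg (n s m : ℕ) : Set where
  field
    init : Fin m → Vec Bool s
    step : Fin m → Vec Bool s → Edge n → Vec Bool s
    out  : Fin m → Vec Bool s → Clustering n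

open StreamAlg public

runList : ∀ {A S : Set} → (S → A → S) → S → List A → S
runList f s [] = s
runList f s (x ∷ xs) = runList f (f s x) xs

run : ∀ {n s m} → StreamAlg n s m → Fin m → List (Edge n) → Clustering n
run A r es = out A r (runList (step A r) (init A r) es)

-- The algorithm outputs an optimal clustering with probability > 2/3 on every
-- input (every labeling, every edge order): the set of good seeds has size
-- strictly more than 2/3 of all m seeds.
Solves : ∀ {n s m} → StreamAlg n s m → Set
Solves {n} {s} {m} A =
  ∀ (L : Labeling n) (σ : List (Fin n × Fin n)) → σ ↭ allPairs n →
  Σ (Subset m) λ G → (2 * m < 3 * ∣ G ∣) × (∀ r → r ∈ G → Optimal L (run A r (stream L σ)))

module Submission where

-- A streaming algorithm with s bits of memory yields a one-way protocol.  On the instance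
-- built below, the edges carrying p²·b input bits x come first, so the memory after them is
-- an s-bit message about x; the remaining edges depend only on a query q < p², and an
-- optimal clustering reveals the whole b-bit block x_q.  Fixing a seed that is good on
-- average, the message determines more than 2/3 of the blocks on average, and counting
-- inputs against messages gives s ≥ b·p²/3 − p².  With b = 4 and n = Θ(p) this is Ω(n²).

open import Defs
open import Data.Nat
open import Data.Nat.Properties
open import Algebra.Properties.CommutativeSemigroup +-commutativeSemigroup
  using () renaming (interchange to +-interchange)
open import Algebra.Properties.CommutativeSemigroup *-commutativeSemigroup
  using () renaming (x∙yz≈y∙zx to x*[y*z]≡y*[z*x]; xy∙z≈xz∙y to x*y*z≡x*z*y)
open import Algebra.Properties.Semiring.Sum +-*-semiring
  using (sum; sum-syntax; sum-cong-≗; ∑-distrib-+; ∑-comm)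
open import Data.Bool using (Bool; true; false; not; _∧_; _∨_; _xor_; if_then_else_; T)
import Data.Bool as Bool
open import Data.Bool.Properties using (∨-comm; T?)
open import Data.Empty using (⊥-elim)
open import Data.Fin using (Fin; zero; suc; toℕ; fromℕ<; _↑ˡ_; _↑ʳ_; splitAt; combine; remQuot)
  renaming (_≟_ to _≟ᶠ_)
open import Data.Fin.Properties
  using ( toℕ-injective; toℕ<n; toℕ-↑ˡ; toℕ-↑ʳ; fromℕ<-cong; fromℕ<-injective
        ; splitAt-↑ˡ; splitAt-↑ʳ; splitAt⁻¹-↑ˡ; splitAt⁻¹-↑ʳ; remQuot-combine; combine-remQuot )
open import Data.Fin.Subset using (Subset; ∣_∣)
open import Data.List using (List; []; _∷_; allFin; partition)
import Data.List as List
import Data.List.Properties as List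
open import Data.List.Relation.Binary.Permutation.Propositional using (_↭_; ↭-sym; ↭ₛ⇒↭)
import Data.List.Relation.Binary.Permutation.Setoid.Properties as Perm
import Data.List.Relation.Unary.All as All
open import Data.List.Relation.Unary.All.Properties using (partition-All)
open import Data.Nat.DivMod using (_/_; _%_; m≡m%n+[m/n]*n; m%n<n; m≥n⇒m/n>0)
open import Data.Nat.ListAction using () renaming (sum to sumˡ)
open import Data.Nat.ListAction.Properties using (sum-++)
open import Data.Nat.Tactic.RingSolver using (solve-∀)
open import Data.Product using (Σ; ∃; _×_; _,_; proj₁; proj₂; uncurry)
open import Data.Sum using (inj₁; inj₂; [_,_]′)
open import Data.Vec using (Vec; []; _∷_; lookup; tabulate)
open import Data.Vec.Functional using () renaming (_∷_ to _◂_)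
open import Data.Vec.Properties using (≡-dec; lookup⇒[]=; tabulate-cong; tabulate∘lookup)
open import Function using (_∘_)
open import Function.Bundles using (mk⇔)
open import Relation.Binary using (tri<; tri≈; tri>)
open import Relation.Binary.PropositionalEquality
open import Relation.Nullary using (¬_; Dec; yes; no; does)
open import Relation.Nullary.Decidable using (dec-true; dec-false; does-⇔)

𝟙 : Bool → ℕ
𝟙 true  = 1
𝟙 false = 0

𝟙≤1 : ∀ e → 𝟙 e ≤ 1
𝟙≤1 true  = ≤-refl
𝟙≤1 false = z≤n

record IsSummation {A : Set} (S : (A → ℕ) → ℕ) : Set where
  field
    cong-≗    : ∀ {f g : A → ℕ} → (∀ a → f a ≡ g a) → S f ≡ S g
    distrib-+ : ∀ (f g : A → ℕ) → S (λ a → f a + g a) ≡ S f + S g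

  zeros : S (λ _ → 0) ≡ 0
  zeros = +-cancelˡ-≡ _ _ _ (trans (sym (distrib-+ (λ _ → 0) (λ _ → 0))) (sym (+-identityʳ _)))

  mono : ∀ {f g : A → ℕ} → (∀ a → f a ≤ g a) → S f ≤ S g
  mono {f} {g} f≤g = begin
    S f                             ≤⟨ m≤m+n (S f) _ ⟩
    S f + S (λ a → g a ∸ f a)       ≡⟨ distrib-+ f _ ⟨
    S (λ a → f a + (g a ∸ f a))     ≡⟨ cong-≗ (λ a → m+[n∸m]≡n (f≤g a)) ⟩
    S g                             ∎
    where open ≤-Reasoning

  *-distribˡ : ∀ c (f : A → ℕ) → S (λ a → c * f a) ≡ c * S f
  *-distribˡ zero    f = zeros
  *-distribˡ (suc c) f = trans (distrib-+ f (λ a → c * f a)) (cong (S f +_) (*-distribˡ c f))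

  *-distribʳ : ∀ c (f : A → ℕ) → S (λ a → f a * c) ≡ S f * c
  *-distribʳ c f = trans (cong-≗ (λ a → *-comm (f a) c)) (trans (*-distribˡ c f) (*-comm c (S f)))

  const : ∀ c → S (λ _ → c) ≡ c * S (λ _ → 1)
  const c = trans (cong-≗ (λ _ → sym (*-identityʳ c))) (*-distribˡ c (λ _ → 1))

sum-isSummation : ∀ n → IsSummation (sum {n})
sum-isSummation n = record { cong-≗ = sum-cong-≗ ; distrib-+ = ∑-distrib-+ }

module ∑ n = IsSummation (sum-isSummation n)

∑-count : ∀ n → ∑[ i < n ] 1 ≡ n
∑-count zero    = refl
∑-count (suc n) = cong suc (∑-count n)

∑-interchange : ∀ {A : Set} {S : (A → ℕ) → ℕ} → IsSummation S → ∀ n (f : Fin n → A → ℕ) →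
  ∑[ i < n ] S (f i) ≡ S (λ a → ∑[ i < n ] f i a)
∑-interchange         isS zero    f = sym (IsSummation.zeros isS)
∑-interchange {S = S} isS (suc n) f =
  trans (cong (S (f zero) +_) (∑-interchange isS n (λ i → f (suc i))))
        (sym (IsSummation.distrib-+ isS (f zero) _))

∑-pigeonhole : ∀ m (f : Fin m → ℕ) c → m * c < ∑[ r < m ] f r → ∃ λ r → c < f r
∑-pigeonhole (suc m) f c h with c <? f zero
... | yes c<f₀ = zero , c<f₀
... | no  c≮f₀ =
  let r , c<fr = ∑-pigeonhole m (λ i → f (suc i)) c
                   (+-cancelˡ-< c _ _ (<-≤-trans h (+-monoˡ-≤ _ (≮⇒≥ c≮f₀))))
  in suc r , c<fr

term≤∑ : ∀ n (f : Fin n → ℕ) i → f i ≤ ∑[ j < n ] f j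
term≤∑ (suc n) f zero    = m≤m+n (f zero) _
term≤∑ (suc n) f (suc i) = ≤-trans (term≤∑ n (λ j → f (suc j)) i) (m≤n+m _ (f zero))

∑-splitAt : ∀ a b (f : Fin (a + b) → ℕ) →
  ∑[ i < a + b ] f i ≡ ∑[ i < a ] f (i ↑ˡ b) + ∑[ j < b ] f (a ↑ʳ j)
∑-splitAt zero    b f = refl
∑-splitAt (suc a) b f = trans (cong (f zero +_) (∑-splitAt a b (λ i → f (suc i)))) (sym (+-assoc (f zero) _ _))

∑ᵛ : ∀ s → (Vec Bool s → ℕ) → ℕ
∑ᵛ zero    f = f []
∑ᵛ (suc s) f = ∑ᵛ s (λ v → f (true ∷ v)) + ∑ᵛ s (λ v → f (false ∷ v))

∑ᵛ-isSummation : ∀ s → IsSummation (∑ᵛ s)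
∑ᵛ-isSummation s = record { cong-≗ = cong-≗ s ; distrib-+ = distrib-+ s }
  where
  cong-≗ : ∀ s {f g : Vec Bool s → ℕ} → (∀ a → f a ≡ g a) → ∑ᵛ s f ≡ ∑ᵛ s g
  cong-≗ zero    f≗g = f≗g []
  cong-≗ (suc s) f≗g = cong₂ _+_ (cong-≗ s (λ v → f≗g (true ∷ v))) (cong-≗ s (λ v → f≗g (false ∷ v)))
  distrib-+ : ∀ s (f g : Vec Bool s → ℕ) → ∑ᵛ s (λ a → f a + g a) ≡ ∑ᵛ s f + ∑ᵛ s g
  distrib-+ zero    f g = refl
  distrib-+ (suc s) f g =
    trans (cong₂ _+_ (distrib-+ s (λ v → f (true ∷ v)) (λ v → g (true ∷ v)))
                     (distrib-+ s (λ v → f (false ∷ v)) (λ v → g (false ∷ v))))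
          (+-interchange (∑ᵛ s (λ v → f (true ∷ v))) (∑ᵛ s (λ v → g (true ∷ v)))
                         (∑ᵛ s (λ v → f (false ∷ v))) (∑ᵛ s (λ v → g (false ∷ v))))

module ∑ᵛ s = IsSummation (∑ᵛ-isSummation s)

∑ᵛ-count : ∀ s → ∑ᵛ s (λ _ → 1) ≡ 2 ^ s
∑ᵛ-count zero    = refl
∑ᵛ-count (suc s) = cong₂ _+_ (∑ᵛ-count s) (trans (∑ᵛ-count s) (sym (+-identityʳ (2 ^ s))))

term≤∑ᵛ : ∀ s (f : Vec Bool s → ℕ) v → f v ≤ ∑ᵛ s f
term≤∑ᵛ zero    f []          = ≤-refl
term≤∑ᵛ (suc s) f (true ∷ v)  = ≤-trans (term≤∑ᵛ s (λ w → f (true ∷ w)) v) (m≤m+n _ _)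
term≤∑ᵛ (suc s) f (false ∷ v) = ≤-trans (term≤∑ᵛ s (λ w → f (false ∷ w)) v) (m≤n+m _ _)

∑ᵛ-interchange : ∀ {A : Set} {S : (A → ℕ) → ℕ} → IsSummation S → ∀ s (f : Vec Bool s → A → ℕ) →
  ∑ᵛ s (λ v → S (f v)) ≡ S (λ a → ∑ᵛ s (λ v → f v a))
∑ᵛ-interchange isS zero    f = refl
∑ᵛ-interchange isS (suc s) f =
  trans (cong₂ _+_ (∑ᵛ-interchange isS s (λ v → f (true ∷ v))) (∑ᵛ-interchange isS s (λ v → f (false ∷ v))))
        (sym (IsSummation.distrib-+ isS _ _))

_≟ᵛ_ : ∀ {s} (u v : Vec Bool s) → Dec (u ≡ v)
_≟ᵛ_ = ≡-dec Bool._≟_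

∑ᵛ-point : ∀ s (y : Vec Bool s) → ∑ᵛ s (λ v → 𝟙 (does (y ≟ᵛ v))) ≡ 1
∑ᵛ-point zero    []          = refl
∑ᵛ-point (suc s) (true ∷ y)  = cong₂ _+_ (∑ᵛ-point s y) (∑ᵛ.zeros s)
∑ᵛ-point (suc s) (false ∷ y) = cong₂ _+_ (∑ᵛ.zeros s) (∑ᵛ-point s y)

Blocks : ℕ → ℕ → Set
Blocks k b = Fin k → Vec Bool b

∑ᵇ : ∀ k b → (Blocks k b → ℕ) → ℕ
∑ᵇ zero    b f = f (λ ())
∑ᵇ (suc k) b f = ∑ᵛ b (λ v → ∑ᵇ k b (λ x → f (v ◂ x)))

∑ᵇ-isSummation : ∀ k b → IsSummation (∑ᵇ k b)
∑ᵇ-isSummation k b = record { cong-≗ = cong-≗ k ; distrib-+ = distrib-+ k }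
  where
  cong-≗ : ∀ k {f g : Blocks k b → ℕ} → (∀ a → f a ≡ g a) → ∑ᵇ k b f ≡ ∑ᵇ k b g
  cong-≗ zero    f≗g = f≗g _
  cong-≗ (suc k) f≗g = ∑ᵛ.cong-≗ b (λ v → cong-≗ k (λ x → f≗g (v ◂ x)))
  distrib-+ : ∀ k (f g : Blocks k b → ℕ) → ∑ᵇ k b (λ a → f a + g a) ≡ ∑ᵇ k b f + ∑ᵇ k b g
  distrib-+ zero    f g = refl
  distrib-+ (suc k) f g =
    trans (∑ᵛ.cong-≗ b (λ v → distrib-+ k (λ x → f (v ◂ x)) (λ x → g (v ◂ x)))) (∑ᵛ.distrib-+ b _ _)

module ∑ᵇ k b = IsSummation (∑ᵇ-isSummation k b)

∑ᵇ-count : ∀ k b → ∑ᵇ k b (λ _ → 1) ≡ (2 ^ b) ^ k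
∑ᵇ-count zero    b = refl
∑ᵇ-count (suc k) b = begin
  ∑ᵛ b (λ _ → ∑ᵇ k b (λ _ → 1)) ≡⟨ ∑ᵛ.cong-≗ b (λ _ → ∑ᵇ-count k b) ⟩
  ∑ᵛ b (λ _ → (2 ^ b) ^ k)      ≡⟨ ∑ᵛ.const b _ ⟩
  (2 ^ b) ^ k * ∑ᵛ b (λ _ → 1)  ≡⟨ cong ((2 ^ b) ^ k *_) (∑ᵛ-count b) ⟩
  (2 ^ b) ^ k * 2 ^ b           ≡⟨ *-comm _ (2 ^ b) ⟩
  2 ^ b * (2 ^ b) ^ k           ∎
  where open ≡-Reasoning

agreement : ∀ {k b} → Blocks k b → Blocks k b → ℕ
agreement {k} x y = ∑[ q < k ] 𝟙 (does (y q ≟ᵛ x q))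

agreement≤k : ∀ {k b} (x y : Blocks k b) → agreement x y ≤ k
agreement≤k {k} x y = ≤-trans (∑.mono k (λ q → 𝟙≤1 _)) (≤-reflexive (∑-count k))

∑ᵛ-weighted-point : ∀ b w (y : Vec Bool b) → ∑ᵛ b (λ v → w ^ 𝟙 (does (y ≟ᵛ v))) ≤ 2 ^ b + w
∑ᵛ-weighted-point b w y = begin
  ∑ᵛ b (λ v → w ^ 𝟙 (does (y ≟ᵛ v)))                  ≤⟨ ∑ᵛ.mono b (λ v → w^𝟙≤1+w*𝟙 (does (y ≟ᵛ v))) ⟩
  ∑ᵛ b (λ v → 1 + w * 𝟙 (does (y ≟ᵛ v)))              ≡⟨ ∑ᵛ.distrib-+ b (λ _ → 1) _ ⟩
  ∑ᵛ b (λ _ → 1) + ∑ᵛ b (λ v → w * 𝟙 (does (y ≟ᵛ v))) ≡⟨ cong₂ _+_ (∑ᵛ-count b) (∑ᵛ.*-distribˡ b w _) ⟩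
  2 ^ b + w * ∑ᵛ b (λ v → 𝟙 (does (y ≟ᵛ v)))          ≡⟨ cong (λ n → 2 ^ b + w * n) (∑ᵛ-point b y) ⟩
  2 ^ b + w * 1                                      ≡⟨ cong (2 ^ b +_) (*-identityʳ w) ⟩
  2 ^ b + w                                          ∎
  where
  open ≤-Reasoning
  w^𝟙≤1+w*𝟙 : ∀ e → w ^ 𝟙 e ≤ 1 + w * 𝟙 e
  w^𝟙≤1+w*𝟙 true  = n≤1+n (w * 1)
  w^𝟙≤1+w*𝟙 false = m≤m+n 1 (w * 0)

∑ᵇ-weighted-agreement : ∀ k b w (y : Blocks k b) → ∑ᵇ k b (λ x → w ^ agreement x y) ≤ (2 ^ b + w) ^ k
∑ᵇ-weighted-agreement zero    b w y = ≤-refl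
∑ᵇ-weighted-agreement (suc k) b w y = begin
  ∑ᵛ b (λ v → ∑ᵇ k b (λ x → w ^ (e v + agreement x y′)))
    ≡⟨ ∑ᵛ.cong-≗ b (λ v → ∑ᵇ.cong-≗ k b (λ x → ^-distribˡ-+-* w (e v) _)) ⟩
  ∑ᵛ b (λ v → ∑ᵇ k b (λ x → w ^ e v * w ^ agreement x y′))
    ≡⟨ ∑ᵛ.cong-≗ b (λ v → ∑ᵇ.*-distribˡ k b (w ^ e v) _) ⟩
  ∑ᵛ b (λ v → w ^ e v * ∑ᵇ k b (λ x → w ^ agreement x y′))
    ≤⟨ ∑ᵛ.mono b (λ v → *-monoʳ-≤ (w ^ e v) (∑ᵇ-weighted-agreement k b w y′)) ⟩
  ∑ᵛ b (λ v → w ^ e v * (2 ^ b + w) ^ k)  ≡⟨ ∑ᵛ.*-distribʳ b _ (λ v → w ^ e v) ⟩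
  ∑ᵛ b (λ v → w ^ e v) * (2 ^ b + w) ^ k  ≤⟨ *-monoˡ-≤ _ (∑ᵛ-weighted-point b w (y zero)) ⟩
  (2 ^ b + w) * (2 ^ b + w) ^ k           ∎
  where
  open ≤-Reasoning
  y′ = λ q → y (suc q)
  e = λ v → 𝟙 (does (y zero ≟ᵛ v))

-- Markov's inequality in the form 3f ≤ k + 2k·[K ≤ f], summed.
markov-threshold : ∀ {A : Set} {S : (A → ℕ) → ℕ} → IsSummation S → ∀ {k} K (f : A → ℕ) →
  3 * K ≤ k → (∀ a → f a ≤ k) →
  2 * k * S (λ _ → 1) < 3 * S f → S (λ _ → 1) < 2 * S (λ a → 𝟙 (does (K ≤? f a)))
markov-threshold {S = S} isS {k} K f 3K≤k f≤k avg = *-cancelˡ-< k _ _ (+-cancelˡ-< (k * N) _ _ (begin-strict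
  k * N + k * N                ≡⟨ cong (k * N +_) (sym (+-identityʳ (k * N))) ⟩
  2 * (k * N)                  ≡⟨ *-assoc 2 k N ⟨
  2 * k * N                    <⟨ avg ⟩
  3 * S f                      ≡⟨ *-distribˡ 3 f ⟨
  S (λ a → 3 * f a)            ≤⟨ mono (λ a → 3f≤k+2k𝟙 (f a) (f≤k a)) ⟩
  S (λ a → k + 2 * k * H a)    ≡⟨ distrib-+ (λ _ → k) _ ⟩
  S (λ _ → k) + S (λ a → 2 * k * H a) ≡⟨ cong₂ _+_ (const k) (*-distribˡ (2 * k) H) ⟩
  k * N + 2 * k * S H          ≡⟨ cong (k * N +_) (trans (cong (_* S H) (*-comm 2 k)) (*-assoc k 2 (S H))) ⟩
  k * N + k * (2 * S H)        ∎))
  where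
  open IsSummation isS
  open ≤-Reasoning
  N = S (λ _ → 1)
  H = λ a → 𝟙 (does (K ≤? f a))
  3f≤k+2k𝟙 : ∀ n → n ≤ k → 3 * n ≤ k + 2 * k * 𝟙 (does (K ≤? n))
  3f≤k+2k𝟙 n n≤k with K ≤? n
  ... | yes K≤n rewrite dec-true (K ≤? n) K≤n = begin
    3 * n           ≤⟨ *-monoʳ-≤ 3 n≤k ⟩
    3 * k           ≡⟨ cong (k +_) (*-identityʳ (2 * k)) ⟨
    k + 2 * k * 1   ∎
  ... | no  n≱K rewrite dec-false (K ≤? n) n≱K = begin
    3 * n           ≤⟨ *-monoʳ-≤ 3 (<⇒≤ (≰⇒> n≱K)) ⟩
    3 * K           ≤⟨ 3K≤k ⟩
    k               ≤⟨ m≤m+n k _ ⟩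
    k + 2 * k * 0   ∎

2^-reflects-< : ∀ {m n} → 2 ^ m < 2 ^ n → m < n
2^-reflects-< 2^m<2^n = ≰⇒> (λ n≤m → <⇒≱ 2^m<2^n (^-monoʳ-≤ 2 n≤m))

threshold≤power : ∀ w .{{_ : NonZero w}} K a → 𝟙 (does (K ≤? a)) * w ^ K ≤ w ^ a
threshold≤power w K a with K ≤? a
... | yes K≤a rewrite dec-true (K ≤? a) K≤a = ≤-trans (≤-reflexive (+-identityʳ (w ^ K))) (^-monoʳ-≤ w K≤a)
... | no  K≰a rewrite dec-false (K ≤? a) K≰a = z≤n

-- Write W = 2^b.  By Markov more than half of the W^k inputs are typical, i.e. agree with
-- their decoding on at least K blocks, so W^k < 2·typical.  But weighting each input by
-- W^agreement, every one of the 2^s messages carries total weight at most (2W)^k, so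
-- typical·W^K ≤ 2^s·(2W)^k.  Together 2^(bK + bk) < 2^(1 + s + k + bk).
one-way-bound : ∀ {k b s} K (enc : Blocks k b → Vec Bool s) (dec : Vec Bool s → Blocks k b) →
  3 * K ≤ k → 2 * k * ∑ᵇ k b (λ _ → 1) < 3 * ∑ᵇ k b (λ x → agreement x (dec (enc x))) →
  b * K ≤ s + k
one-way-bound {k} {b} {s} K enc dec 3K≤k avg =
  ≤-pred (+-cancelʳ-< (b * k) (b * K) (suc (s + k)) (2^-reflects-< (begin-strict
    2 ^ (b * K + b * k)         ≡⟨ ^-distribˡ-+-* 2 (b * K) (b * k) ⟩
    2 ^ (b * K) * 2 ^ (b * k)   ≡⟨ cong₂ _*_ (^-*-assoc 2 b K) (^-*-assoc 2 b k) ⟨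
    W ^ K * W ^ k               <⟨ *-monoʳ-< (W ^ K) {{m^n≢0 W K}} many-typical ⟩
    W ^ K * (2 * typical)       ≡⟨ x*[y*z]≡y*[z*x] (W ^ K) 2 typical ⟩
    2 * (typical * W ^ K)       ≤⟨ *-monoʳ-≤ 2 few-typical ⟩
    2 * ((W + W) ^ k * 2 ^ s)   ≡⟨ cong (2 *_) (*-comm _ (2 ^ s)) ⟩
    2 * (2 ^ s * (W + W) ^ k)   ≡⟨ cong (λ n → 2 * (2 ^ s * n ^ k)) (cong (W +_) (+-identityʳ W)) ⟨
    2 * (2 ^ s * (2 * W) ^ k)   ≡⟨ cong (λ n → 2 * (2 ^ s * n)) (^-*-assoc 2 (suc b) k) ⟩
    2 * (2 ^ s * 2 ^ (k + b * k)) ≡⟨ cong (2 *_) (^-distribˡ-+-* 2 s (k + b * k)) ⟨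
    2 ^ suc (s + (k + b * k))   ≡⟨ cong (λ n → 2 ^ suc n) (+-assoc s k (b * k)) ⟨
    2 ^ (suc (s + k) + b * k)   ∎)))
  where
  open ≤-Reasoning
  W = 2 ^ b
  instance
    W≢0 : NonZero W
    W≢0 = m^n≢0 2 b
  A = λ x → agreement x (dec (enc x))
  typical = ∑ᵇ k b (λ x → 𝟙 (does (K ≤? A x)))

  many-typical : W ^ k < 2 * typical
  many-typical = subst (_< 2 * typical) (∑ᵇ-count k b)
    (markov-threshold (∑ᵇ-isSummation k b) K A 3K≤k (λ x → agreement≤k x (dec (enc x))) avg)

  few-typical : typical * W ^ K ≤ (W + W) ^ k * 2 ^ s
  few-typical = begin
    typical * W ^ K                                       ≡⟨ ∑ᵇ.*-distribʳ k b (W ^ K) _ ⟨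
    ∑ᵇ k b (λ x → 𝟙 (does (K ≤? A x)) * W ^ K)            ≤⟨ ∑ᵇ.mono k b (λ x → threshold≤power W K (A x)) ⟩
    ∑ᵇ k b (λ x → W ^ A x)
      ≤⟨ ∑ᵇ.mono k b (λ x → term≤∑ᵛ s (λ M → W ^ agreement x (dec M)) (enc x)) ⟩
    ∑ᵇ k b (λ x → ∑ᵛ s (λ M → W ^ agreement x (dec M)))
      ≡⟨ ∑ᵛ-interchange (∑ᵇ-isSummation k b) s (λ M x → W ^ agreement x (dec M)) ⟨
    ∑ᵛ s (λ M → ∑ᵇ k b (λ x → W ^ agreement x (dec M)))  ≤⟨ ∑ᵛ.mono s (λ M → ∑ᵇ-weighted-agreement k b W (dec M)) ⟩
    ∑ᵛ s (λ _ → (W + W) ^ k)                              ≡⟨ ∑ᵛ.const s _ ⟩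
    (W + W) ^ k * ∑ᵛ s (λ _ → 1)                          ≡⟨ cong ((W + W) ^ k *_) (∑ᵛ-count s) ⟩
    (W + W) ^ k * 2 ^ s                                   ∎

∣∣≡∑𝟙 : ∀ {m} (G : Subset m) → ∣ G ∣ ≡ ∑[ r < m ] 𝟙 (lookup G r)
∣∣≡∑𝟙 []          = refl
∣∣≡∑𝟙 (true ∷ G)  = cong suc (∣∣≡∑𝟙 G)
∣∣≡∑𝟙 (false ∷ G) = ∣∣≡∑𝟙 G

averaging : ∀ {A : Set} {S : (A → ℕ) → ℕ} → IsSummation S → ∀ k m (good : A → Fin k → Fin m → ℕ) →
  (∀ a q → 2 * m < 3 * ∑[ r < m ] good a q r) → 1 ≤ k → 1 ≤ S (λ _ → 1) →
  ∃ λ r → 2 * k * S (λ _ → 1) < 3 * S (λ a → ∑[ q < k ] good a q r)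
averaging {S = S} isS k m good majority 1≤k 1≤size = ∑-pigeonhole m (λ r → 3 * S (λ a → ∑[ q < k ] good a q r)) (2 * k * size)
  (begin-strict
    m * (2 * k * size)                                    <⟨ m*[2kN]<N*[k*[1+2m]] ⟩
    size * (k * suc (2 * m))                              ≡⟨ trans (*-comm size _) (sym (const _)) ⟩
    S (λ _ → k * suc (2 * m))                           ≡⟨ cong-≗ (λ _ → ∑-replicate) ⟩
    S (λ a → ∑[ q < k ] suc (2 * m))                     ≤⟨ mono (λ a → ∑.mono k (majority a)) ⟩
    S (λ a → ∑[ q < k ] (3 * ∑[ r < m ] good a q r))     ≡⟨ swap ⟩
    ∑[ r < m ] (3 * S (λ a → ∑[ q < k ] good a q r))     ∎)
  where
  open IsSummation isS
  open ≤-Reasoning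
  size = S (λ _ → 1)
  ∑-replicate : k * suc (2 * m) ≡ ∑[ q < k ] suc (2 * m)
  ∑-replicate = sym (trans (∑.const k (suc (2 * m))) (trans (cong (suc (2 * m) *_) (∑-count k)) (*-comm (suc (2 * m)) k)))
  m*[2kN]<N*[k*[1+2m]] : m * (2 * k * size) < size * (k * suc (2 * m))
  m*[2kN]<N*[k*[1+2m]] = begin-strict
    m * (2 * k * size)           <⟨ m<n+m (m * (2 * k * size)) (*-mono-≤ 1≤size 1≤k) ⟩
    size * k + m * (2 * k * size)  ≡⟨ rearrange size k m ⟩
    size * (k * suc (2 * m))     ∎
    where
    rearrange : ∀ N k m → N * k + m * (2 * k * N) ≡ N * (k * suc (2 * m))
    rearrange = solve-∀
  swap : S (λ a → ∑[ q < k ] (3 * ∑[ r < m ] good a q r)) ≡ ∑[ r < m ] (3 * S (λ a → ∑[ q < k ] good a q r))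
  swap = begin-equality
    S (λ a → ∑[ q < k ] (3 * ∑[ r < m ] good a q r))  ≡⟨ cong-≗ (λ a → ∑.*-distribˡ k 3 _) ⟩
    S (λ a → 3 * ∑[ q < k ] ∑[ r < m ] good a q r)    ≡⟨ *-distribˡ 3 _ ⟩
    3 * S (λ a → ∑[ q < k ] ∑[ r < m ] good a q r)    ≡⟨ cong (3 *_) (cong-≗ (λ a → ∑-comm (good a))) ⟩
    3 * S (λ a → ∑[ r < m ] ∑[ q < k ] good a q r)    ≡⟨ cong (3 *_) (∑-interchange isS m (λ r a → ∑[ q < k ] good a q r)) ⟨
    3 * ∑[ r < m ] S (λ a → ∑[ q < k ] good a q r)    ≡⟨ ∑.*-distribˡ m 3 _ ⟨
    ∑[ r < m ] (3 * S (λ a → ∑[ q < k ] good a q r))  ∎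

∑² : ∀ n → (Fin n → Fin n → ℕ) → ℕ
∑² n f = ∑[ i < n ] ∑[ j < n ] f i j

∑²-cong : ∀ n {f g : Fin n → Fin n → ℕ} → (∀ i j → f i j ≡ g i j) → ∑² n f ≡ ∑² n g
∑²-cong n f≗g = ∑.cong-≗ n (λ i → ∑.cong-≗ n (f≗g i))

∑²-mono : ∀ n {f g : Fin n → Fin n → ℕ} → (∀ i j → f i j ≤ g i j) → ∑² n f ≤ ∑² n g
∑²-mono n f≤g = ∑.mono n (λ i → ∑.mono n (f≤g i))

∑²-distrib-+ : ∀ n (f g : Fin n → Fin n → ℕ) → ∑² n (λ i j → f i j + g i j) ≡ ∑² n f + ∑² n g
∑²-distrib-+ n f g = trans (∑.cong-≗ n (λ i → ∑.distrib-+ n (f i) (g i))) (∑.distrib-+ n _ _)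

∑²-*ʳ : ∀ n (f : Fin n → Fin n → ℕ) c → ∑² n (λ i j → f i j * c) ≡ ∑² n f * c
∑²-*ʳ n f c = trans (∑.cong-≗ n (λ i → ∑.*-distribʳ n c (f i))) (∑.*-distribʳ n c _)

∑²-*ˡ : ∀ n c (f : Fin n → Fin n → ℕ) → ∑² n (λ i j → c * f i j) ≡ c * ∑² n f
∑²-*ˡ n c f = trans (∑.cong-≗ n (λ i → ∑.*-distribˡ n c (f i))) (∑.*-distribˡ n c _)

∑²-transpose : ∀ n (f : Fin n → Fin n → ℕ) → ∑² n (λ i j → f j i) ≡ ∑² n f
∑²-transpose n f = ∑-comm (λ i j → f j i)

term≤∑² : ∀ n (f : Fin n → Fin n → ℕ) i j → f i j ≤ ∑² n f
term≤∑² n f i j = ≤-trans (term≤∑ n (f i) j) (term≤∑ n (λ i → ∑[ j < n ] f i j) i)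

upper : ∀ {n} → Fin n → Fin n → ℕ → ℕ
upper i j v = if toℕ i <ᵇ toℕ j then v else 0

upper-distrib-+ : ∀ {n} (i j : Fin n) u v → upper i j (u + v) ≡ upper i j u + upper i j v
upper-distrib-+ i j u v with toℕ i <ᵇ toℕ j
... | true  = refl
... | false = refl

upper-mono : ∀ {n} (i j : Fin n) {u v} → (i ≢ j → u ≤ v) → upper i j u ≤ upper i j v
upper-mono i j u≤v with toℕ i <? toℕ j
... | yes i<j rewrite dec-true  (toℕ i <? toℕ j) i<j = u≤v (λ i≡j → <-irrefl (cong toℕ i≡j) i<j)
... | no  i≮j rewrite dec-false (toℕ i <? toℕ j) i≮j = z≤n

∑²≡2*upper : ∀ n (f : Fin n → Fin n → ℕ) → (∀ i j → f i j ≡ f j i) → (∀ i → f i i ≡ 0) →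
  ∑² n f ≡ 2 * ∑² n (λ i j → upper i j (f i j))
∑²≡2*upper n f sym-f diag-f = begin
  ∑² n f                                          ≡⟨ ∑²-cong n split ⟩
  ∑² n (λ i j → U i j + upper j i (f i j))        ≡⟨ ∑²-distrib-+ n U _ ⟩
  ∑² n U + ∑² n (λ i j → upper j i (f i j))
    ≡⟨ cong (∑² n U +_) (trans (∑²-cong n (λ i j → cong (upper j i) (sym-f i j))) (∑²-transpose n U)) ⟩
  ∑² n U + ∑² n U                                 ≡⟨ cong (∑² n U +_) (+-identityʳ (∑² n U)) ⟨
  2 * ∑² n U                                      ∎
  where
  open ≡-Reasoning
  U = λ i j → upper i j (f i j)
  split : ∀ i j → f i j ≡ upper i j (f i j) + upper j i (f i j)
  split i j with <-cmp (toℕ i) (toℕ j)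
  ... | tri< i<j _ j≮i rewrite dec-true (toℕ i <? toℕ j) i<j | dec-false (toℕ j <? toℕ i) j≮i =
    sym (+-identityʳ (f i j))
  ... | tri> i≮j _ j<i rewrite dec-false (toℕ i <? toℕ j) i≮j | dec-true (toℕ j <? toℕ i) j<i = refl
  ... | tri≈ i≮j i≡j j≮i rewrite dec-false (toℕ i <? toℕ j) i≮j | dec-false (toℕ j <? toℕ i) j≮i
    with toℕ-injective i≡j
  ... | refl = diag-f i

cost-as-∑² : ∀ {n} (L : Labeling n) (C : Clustering n) →
  cost L C ≡ ∑² n (λ i j → upper i j (disagree L C (i , j)))
cost-as-∑² {n} L C =
  trans (sumˡ-concatMap (allFin n))
    (trans (sumˡ-cong (allFin n) (λ i →
             trans (sumˡ-concatMap (allFin n))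
               (trans (sumˡ-cong (allFin n) (λ j → sumˡ-singleton-if (toℕ i <ᵇ toℕ j) (i , j)))
                      (sumˡ-allFin n _))))
           (sumˡ-allFin n _))
  where
  d = disagree L C
  sumˡ-cong : ∀ {A : Set} {f g : A → ℕ} xs → (∀ a → f a ≡ g a) → sumˡ (List.map f xs) ≡ sumˡ (List.map g xs)
  sumˡ-cong xs f≗g = cong sumˡ (List.map-cong f≗g xs)
  sumˡ-concatMap : ∀ {A : Set} {g : A → List (Fin n × Fin n)} xs →
    sumˡ (List.map d (List.concatMap g xs)) ≡ sumˡ (List.map (λ a → sumˡ (List.map d (g a))) xs)
  sumˡ-concatMap         []       = refl
  sumˡ-concatMap {g = g} (a ∷ xs) = begin
    sumˡ (List.map d (g a List.++ List.concatMap g xs))             ≡⟨ cong sumˡ (List.map-++ d (g a) _) ⟩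
    sumˡ (List.map d (g a) List.++ List.map d (List.concatMap g xs)) ≡⟨ sum-++ (List.map d (g a)) _ ⟩
    sumˡ (List.map d (g a)) + sumˡ (List.map d (List.concatMap g xs)) ≡⟨ cong (_ +_) (sumˡ-concatMap xs) ⟩
    sumˡ (List.map d (g a)) + sumˡ (List.map (λ a → sumˡ (List.map d (g a))) xs) ∎
    where open ≡-Reasoning
  sumˡ-singleton-if : ∀ c e → sumˡ (List.map d (if c then List.[ e ] else [])) ≡ (if c then d e else 0)
  sumˡ-singleton-if true  e = +-identityʳ (d e)
  sumˡ-singleton-if false e = refl
  sumˡ-allFin : ∀ m (f : Fin m → ℕ) → sumˡ (List.map f (allFin m)) ≡ ∑[ i < m ] f i
  sumˡ-allFin m f = trans (cong sumˡ (List.map-tabulate (λ i → i) f)) (sumˡ-tabulate m f)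
    where
    sumˡ-tabulate : ∀ m (f : Fin m → ℕ) → sumˡ (List.tabulate f) ≡ ∑[ i < m ] f i
    sumˡ-tabulate zero    f = refl
    sumˡ-tabulate (suc m) f = cong (f zero +_) (sumˡ-tabulate m (λ i → f (suc i)))

mismatch : Bool → Bool → ℕ
mismatch l s = 𝟙 (l xor s)

mismatch≡0⇒≡ : ∀ l s → mismatch l s ≡ 0 → l ≡ s
mismatch≡0⇒≡ true  true  _ = refl
mismatch≡0⇒≡ false false _ = refl

mismatch-refl : ∀ l → mismatch l l ≡ 0
mismatch-refl true  = refl
mismatch-refl false = refl

disagree≡mismatch : ∀ {n} (L : Labeling n) (C : Clustering n) i j →
  disagree L C (i , j) ≡ mismatch (L i j) (does (C i ≟ᶠ C j))
disagree≡mismatch L C i j with L i j | does (C i ≟ᶠ C j)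
... | true  | true  = refl
... | true  | false = refl
... | false | true  = refl
... | false | false = refl

does-fromℕ<-≟ : ∀ {m m′ o} (m<o : m < o) (m′<o : m′ < o) → does (fromℕ< m<o ≟ᶠ fromℕ< m′<o) ≡ does (m ≟ m′)
does-fromℕ<-≟ {m} {m′} m<o m′<o =
  does-⇔ (mk⇔ (fromℕ<-injective m m′ m<o m′<o) (λ m≡m′ → fromℕ<-cong m m′ m≡m′ m<o m′<o))
         (fromℕ< m<o ≟ᶠ fromℕ< m′<o) (m ≟ m′)

m≤1⇒m≤m*n : ∀ m n → m ≤ 1 → (m ≡ 1 → 1 ≤ n) → m ≤ m * n
m≤1⇒m≤m*n zero          n _        _     = z≤n
m≤1⇒m≤m*n (suc zero)    n _        1⇒1≤n = ≤-trans (1⇒1≤n refl) (≤-reflexive (sym (+-identityʳ n)))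
m≤1⇒m≤m*n (suc (suc m)) n (s≤s ()) _

if-T : ∀ {A : Set} {c : Bool} {a a′ : A} → T c → (if c then a else a′) ≡ a
if-T {c = true} _ = refl

if-¬T : ∀ {A : Set} {c : Bool} {a a′ : A} → ¬ T c → (if c then a else a′) ≡ a′
if-¬T {c = true}  ¬t = ⊥-elim (¬t _)
if-¬T {c = false} _  = refl

does⇒ : ∀ {A : Set} (a? : Dec A) → does a? ≡ true → A
does⇒ (yes a) _ = a

-- Labels of the edges ab, ac, bc of a triangle with exactly one negative edge.
data OneMinus : Bool → Bool → Bool → Set where
  minus₁ : OneMinus false true  true
  minus₂ : OneMinus true  false true
  minus₃ : OneMinus true  true  false

equality-not-OneMinus : ∀ {n} (a b c : Fin n) → ¬ OneMinus (does (a ≟ᶠ b)) (does (a ≟ᶠ c)) (does (b ≟ᶠ c))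
equality-not-OneMinus a b c o with a ≟ᶠ b | a ≟ᶠ c | b ≟ᶠ c | o
... | no  a≢b | yes a≡c | yes b≡c | minus₁ = a≢b (trans a≡c (sym b≡c))
... | yes a≡b | no  a≢c | yes b≡c | minus₂ = a≢c (trans a≡b b≡c)
... | yes a≡b | yes a≡c | no  b≢c | minus₃ = b≢c (trans (sym a≡b) a≡c)

OneMinus-disagrees : ∀ {n} (a b c : Fin n) {l₁ l₂ l₃} → OneMinus l₁ l₂ l₃ →
  1 ≤ mismatch l₁ (does (a ≟ᶠ b)) + mismatch l₂ (does (a ≟ᶠ c)) + mismatch l₃ (does (b ≟ᶠ c))
OneMinus-disagrees a b c {l₁} {l₂} {l₃} o
  with mismatch l₁ (does (a ≟ᶠ b)) in e₁ | mismatch l₂ (does (a ≟ᶠ c)) in e₂ | mismatch l₃ (does (b ≟ᶠ c)) in e₃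
... | suc _ | _     | _     = s≤s z≤n
... | zero  | suc _ | _     = s≤s z≤n
... | zero  | zero  | suc _ = s≤s z≤n
... | zero  | zero  | zero
  with mismatch≡0⇒≡ l₁ _ e₁ | mismatch≡0⇒≡ l₂ _ e₂ | mismatch≡0⇒≡ l₃ _ e₃
...   | refl | refl | refl = ⊥-elim (equality-not-OneMinus a b c o)

runList-++ : ∀ {A S : Set} (f : S → A → S) s (xs ys : List A) →
  runList f s (xs List.++ ys) ≡ runList f (runList f s xs) ys
runList-++ f s []       ys = refl
runList-++ f s (x ∷ xs) ys = runList-++ f (f s x) xs ys

-- 1 exactly for a bit pair, not between two active vertices, whose bit differs from the
-- label it would carry as an ordinary pair.
deviation : (isBit v α β : Bool) → ℕ
deviation isBit v α β = if isBit ∧ not (α ∧ β) then mismatch v (not (α ∨ β)) else 0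

deviation≤𝟙 : ∀ isBit v α β → deviation isBit v α β ≤ 𝟙 isBit
deviation≤𝟙 false v α     β     = z≤n
deviation≤𝟙 true  v true  true  = z≤n
deviation≤𝟙 true  v true  false = 𝟙≤1 _
deviation≤𝟙 true  v false β     = 𝟙≤1 _

deviation-OneMinus : ∀ isBit v α β → deviation isBit v α β ≡ 1 →
  OneMinus (if isBit then v else not (α ∨ β)) (not (α ∨ false)) (not (β ∨ false))
deviation-OneMinus true  false false false _ = minus₁
deviation-OneMinus true  true  true  false _ = minus₂
deviation-OneMinus true  true  false true  _ = minus₃
deviation-OneMinus false _     _     _     ()
deviation-OneMinus true  false true  false ()
deviation-OneMinus true  false false true  ()
deviation-OneMinus true  true  false false ()
deviation-OneMinus true  _     true  true  ()

mismatch-unless-both : ∀ isBit v α β → (α ∧ β) ≡ false →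
  mismatch (if isBit then v else not (α ∨ β)) (not (α ∨ β)) ≤ deviation isBit v α β
mismatch-unless-both true  v α β αβ rewrite αβ = ≤-refl
mismatch-unless-both false v α β _             = ≤-reflexive (mismatch-refl (not (α ∨ β)))

-- Vertices left a t and right c t (a, c < p, t < b) and z pad vertices.  The input bit
-- x(a,c)ₜ labels the edge {left a t, right c t}; every other edge is negative iff it touches
-- an active vertex, left a₀ t or right c₀ t for the query q = (a₀, c₀).  A suitable
-- clustering pays only for deviant pairs, and every clustering pays for those through the
-- bad triangles they form with the pads, so an optimal one must agree with the label of
-- {left a₀ t, right c₀ t}, which is x(a₀,c₀)ₜ.
module HardInstance (p b z : ℕ) where

  N : ℕ
  N = p * b + (p * b + z)

  data Node : Set where
    left right : Fin p → Fin b → Node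
    pad        : Fin z → Node

  fromLeft fromRight : Fin (p * b) → Node
  fromLeft  i = uncurry left  (remQuot {p} b i)
  fromRight i = uncurry right (remQuot {p} b i)

  node : Fin N → Node
  node i = [ fromLeft , [ fromRight , pad ]′ ∘ splitAt (p * b) ]′ (splitAt (p * b) i)

  vertex : Node → Fin N
  vertex (left a t)  = combine a t ↑ˡ (p * b + z)
  vertex (right c t) = p * b ↑ʳ (combine c t ↑ˡ z)
  vertex (pad l)     = p * b ↑ʳ (p * b ↑ʳ l)

  node-vertex : ∀ n → node (vertex n) ≡ n
  node-vertex (left a t)  rewrite splitAt-↑ˡ (p * b) (combine a t) (p * b + z) =
    cong (uncurry left) (remQuot-combine a t)
  node-vertex (right c t) rewrite splitAt-↑ʳ (p * b) (p * b + z) (combine c t ↑ˡ z)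
                                | splitAt-↑ˡ (p * b) (combine c t) z =
    cong (uncurry right) (remQuot-combine c t)
  node-vertex (pad l)     rewrite splitAt-↑ʳ (p * b) (p * b + z) (p * b ↑ʳ l)
                                | splitAt-↑ʳ (p * b) z l = refl

  vertex-node : ∀ i → vertex (node i) ≡ i
  vertex-node i with splitAt (p * b) i in e
  ... | inj₁ i′ = trans (cong (_↑ˡ (p * b + z)) (combine-remQuot {p} b i′)) (splitAt⁻¹-↑ˡ e)
  ... | inj₂ j with splitAt (p * b) j in e′
  ...   | inj₁ j′ = trans (cong (λ k → p * b ↑ʳ (k ↑ˡ z)) (combine-remQuot {p} b j′))
                          (trans (cong (p * b ↑ʳ_) (splitAt⁻¹-↑ˡ e′)) (splitAt⁻¹-↑ʳ e))
  ...   | inj₂ l  = trans (cong (p * b ↑ʳ_) (splitAt⁻¹-↑ʳ e′)) (splitAt⁻¹-↑ʳ e)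

  node-injective : ∀ {i j} → node i ≡ node j → i ≡ j
  node-injective {i} {j} eq = trans (sym (vertex-node i)) (trans (cong vertex eq) (vertex-node j))

  ∑-node : ∀ (F : Node → ℕ) → ∑[ i < N ] F (node i) ≡
    ∑[ i < p * b ] F (fromLeft i) + (∑[ i < p * b ] F (fromRight i) + ∑[ l < z ] F (pad l))
  ∑-node F = trans (∑-splitAt (p * b) (p * b + z) _) (cong₂ _+_
    (∑.cong-≗ (p * b) (λ i → cong (F ∘ [ fromLeft , _ ]′) (splitAt-↑ˡ (p * b) i (p * b + z))))
    (trans (∑.cong-≗ (p * b + z) (λ j → cong (F ∘ [ _ , [ fromRight , pad ]′ ∘ splitAt (p * b) ]′)
                                              (splitAt-↑ʳ (p * b) (p * b + z) j)))
           (trans (∑-splitAt (p * b) z _) (cong₂ _+_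
             (∑.cong-≗ (p * b) (λ i → cong (F ∘ [ fromRight , pad ]′) (splitAt-↑ˡ (p * b) i z)))
             (∑.cong-≗ z (λ l → cong (F ∘ [ fromRight , pad ]′) (splitAt-↑ʳ (p * b) z l)))))))

  isLeft isRight isPad : Node → Bool
  isLeft (left _ _)   = true
  isLeft _            = false
  isRight (right _ _) = true
  isRight _           = false
  isPad (pad _)       = true
  isPad _             = false

  count-left : ∑[ i < N ] 𝟙 (isLeft (node i)) ≡ p * b
  count-left = trans (∑-node (𝟙 ∘ isLeft))
    (trans (cong₂ _+_ (∑-count (p * b)) (cong₂ _+_ (∑.zeros (p * b)) (∑.zeros z))) (+-identityʳ (p * b)))

  count-right : ∑[ i < N ] 𝟙 (isRight (node i)) ≡ p * b
  count-right = trans (∑-node (𝟙 ∘ isRight)) (cong₂ _+_ (∑.zeros (p * b))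
    (trans (cong₂ _+_ (∑-count (p * b)) (∑.zeros z)) (+-identityʳ (p * b))))

  count-pad : ∑[ i < N ] 𝟙 (isPad (node i)) ≡ z
  count-pad = trans (∑-node (𝟙 ∘ isPad)) (cong₂ _+_ (∑.zeros (p * b)) (cong₂ _+_ (∑.zeros (p * b)) (∑-count z)))

  Query : Set
  Query = Fin (p * p)

  Input : Set
  Input = Blocks (p * p) b

  qˡ qʳ : Query → Fin p
  qˡ q = proj₁ (remQuot {p} p q)
  qʳ q = proj₂ (remQuot {p} p q)

  active : Query → Node → Bool
  active q (left a _)  = does (a ≟ᶠ qˡ q)
  active q (right c _) = does (c ≟ᶠ qʳ q)
  active q (pad _)     = false

  bitPair : Node → Node → Bool
  bitPair (left _ t)  (right _ t′) = does (t ≟ᶠ t′)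
  bitPair (right _ t′) (left _ t)  = does (t ≟ᶠ t′)
  bitPair _ _ = false

  bit : Input → Node → Node → Bool
  bit x (left a t)  (right c _) = lookup (x (combine a c)) t
  bit x (right c _) (left a t)  = lookup (x (combine a c)) t
  bit x _ _ = false

  label : Input → Query → Node → Node → Bool
  label x q n n′ = if bitPair n n′ then bit x n n′ else not (active q n ∨ active q n′)

  hard : Input → Query → Labeling N
  hard x q i j = label x q (node i) (node j)

  bitPair-sym : ∀ n n′ → bitPair n n′ ≡ bitPair n′ n
  bitPair-sym (left _ _)  (left _ _)  = refl
  bitPair-sym (left _ _)  (right _ _) = refl
  bitPair-sym (left _ _)  (pad _)     = refl
  bitPair-sym (right _ _) (left _ _)  = refl
  bitPair-sym (right _ _) (right _ _) = refl
  bitPair-sym (right _ _) (pad _)     = refl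
  bitPair-sym (pad _)     (left _ _)  = refl
  bitPair-sym (pad _)     (right _ _) = refl
  bitPair-sym (pad _)     (pad _)     = refl

  bit-sym : ∀ x n n′ → bit x n n′ ≡ bit x n′ n
  bit-sym x (left _ _)  (left _ _)  = refl
  bit-sym x (left _ _)  (right _ _) = refl
  bit-sym x (left _ _)  (pad _)     = refl
  bit-sym x (right _ _) (left _ _)  = refl
  bit-sym x (right _ _) (right _ _) = refl
  bit-sym x (right _ _) (pad _)     = refl
  bit-sym x (pad _)     (left _ _)  = refl
  bit-sym x (pad _)     (right _ _) = refl
  bit-sym x (pad _)     (pad _)     = refl

  label-sym : ∀ x q n n′ → label x q n n′ ≡ label x q n′ n
  label-sym x q n n′ rewrite bitPair-sym n n′ | bit-sym x n n′ | ∨-comm (active q n) (active q n′) = refl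

  deviant : Input → Query → Node → Node → ℕ
  deviant x q n n′ = deviation (bitPair n n′) (bit x n n′) (active q n) (active q n′)

  deviant-sym : ∀ x q n n′ → deviant x q n n′ ≡ deviant x q n′ n
  deviant-sym x q n n′ rewrite bitPair-sym n n′ | bit-sym x n n′ with active q n | active q n′
  ... | true  | true  = refl
  ... | true  | false = refl
  ... | false | true  = refl
  ... | false | false = refl

  bitPair-irrefl : ∀ n → bitPair n n ≡ false
  bitPair-irrefl (left _ _)  = refl
  bitPair-irrefl (right _ _) = refl
  bitPair-irrefl (pad _)     = refl

  deviant-irrefl : ∀ x q n → deviant x q n n ≡ 0
  deviant-irrefl x q n rewrite bitPair-irrefl n = refl

  -- An active left a₀ t sits in cluster t, joined by right c₀ t iff its bit is 1 (else that
  -- vertex is alone in cluster b + t); all inactive vertices form the cluster 2b.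
  slot : Input → Query → Node → ℕ
  slot x q (left _ t)  = toℕ t
  slot x q (right c t) = if lookup (x (combine (qˡ q) c)) t then toℕ t else b + toℕ t
  slot x q (pad _)     = 0

  code : Input → Query → Node → ℕ
  code x q n = if active q n then slot x q n else 2 * b

  slot<2b : ∀ x q n → active q n ≡ true → slot x q n < 2 * b
  slot<2b x q (left _ t)  _ = <-≤-trans (toℕ<n t) (m≤m+n b (b + 0))
  slot<2b x q (right c t) _ with lookup (x (combine (qˡ q) c)) t
  ... | true  = <-≤-trans (toℕ<n t) (m≤m+n b (b + 0))
  ... | false = +-monoʳ-< b (<-≤-trans (toℕ<n t) (m≤m+n b 0))

  code≤2b : ∀ x q n → code x q n ≤ 2 * b
  code≤2b x q n with active q n in α
  ... | true  = <⇒≤ (slot<2b x q n α)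
  ... | false = ≤-refl

  same-code-unless-both-active : ∀ x q n n′ → (active q n ∧ active q n′) ≡ false →
    does (code x q n ≟ code x q n′) ≡ not (active q n ∨ active q n′)
  same-code-unless-both-active x q n n′ _ with active q n in α | active q n′ in β
  ... | false | false = dec-true (2 * b ≟ 2 * b) refl
  ... | true  | false = dec-false (slot x q n ≟ 2 * b) (<⇒≢ (slot<2b x q n α))
  ... | false | true  = dec-false (2 * b ≟ slot x q n′) (≢-sym (<⇒≢ (slot<2b x q n′ β)))

  left-right-label≡same-slot : ∀ (v : Vec Bool b) (t t′ : Fin b) →
    (if does (t ≟ᶠ t′) then lookup v t else false) ≡ does (toℕ t ≟ (if lookup v t′ then toℕ t′ else b + toℕ t′))
  left-right-label≡same-slot v t t′ with t ≟ᶠ t′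
  ... | yes refl with lookup v t
  ...   | true  = sym (dec-true (toℕ t ≟ toℕ t) refl)
  ...   | false = sym (dec-false (toℕ t ≟ b + toℕ t) (<⇒≢ (<-≤-trans (toℕ<n t) (m≤m+n b (toℕ t)))))
  left-right-label≡same-slot v t t′ | no t≢t′ with lookup v t′
  ...   | true  = sym (dec-false (toℕ t ≟ toℕ t′) (t≢t′ ∘ toℕ-injective))
  ...   | false = sym (dec-false (toℕ t ≟ b + toℕ t′) (<⇒≢ (<-≤-trans (toℕ<n t) (m≤m+n b (toℕ t′)))))

  label≡same-slot : ∀ x q n n′ → n ≢ n′ → active q n ≡ true → active q n′ ≡ true →
    label x q n n′ ≡ does (slot x q n ≟ slot x q n′)
  label≡same-slot x q (pad _) _ _ () _
  label≡same-slot x q _ (pad _) _ _ ()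
  label≡same-slot x q (left a t) (left a′ t′) n≢n′ α β
    with refl ← does⇒ (a ≟ᶠ qˡ q) α | refl ← does⇒ (a′ ≟ᶠ qˡ q) β rewrite α =
    sym (dec-false (toℕ t ≟ toℕ t′) (n≢n′ ∘ cong (left a) ∘ toℕ-injective))
  label≡same-slot x q (right c t) (right c′ t′) n≢n′ α β
    with refl ← does⇒ (c ≟ᶠ qʳ q) α | refl ← does⇒ (c′ ≟ᶠ qʳ q) β rewrite α =
    sym (dec-false (slot x q (right c t) ≟ slot x q (right c t′))
                   (right-slot-injective (lookup v t) (lookup v t′) (n≢n′ ∘ cong (right c))))
    where
    v = x (combine (qˡ q) c)
    right-slot-injective : ∀ (e e′ : Bool) {t t′ : Fin b} → t ≢ t′ →
      (if e then toℕ t else b + toℕ t) ≢ (if e′ then toℕ t′ else b + toℕ t′)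
    right-slot-injective true  true  t≢t′ = t≢t′ ∘ toℕ-injective
    right-slot-injective true  false {t} {t′} _ = <⇒≢ (<-≤-trans (toℕ<n t) (m≤m+n b (toℕ t′)))
    right-slot-injective false true  {t} {t′} _ = ≢-sym (<⇒≢ (<-≤-trans (toℕ<n t′) (m≤m+n b (toℕ t))))
    right-slot-injective false false t≢t′ = t≢t′ ∘ toℕ-injective ∘ +-cancelˡ-≡ b _ _
  label≡same-slot x q (left a t) (right c t′) n≢n′ α β
    with refl ← does⇒ (a ≟ᶠ qˡ q) α | refl ← does⇒ (c ≟ᶠ qʳ q) β rewrite α =
    left-right-label≡same-slot (x (combine (qˡ q) (qʳ q))) t t′
  label≡same-slot x q (right c t′) (left a t) n≢n′ α β =
    trans (label-sym x q (right c t′) (left a t))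
      (trans (label≡same-slot x q (left a t) (right c t′) (≢-sym n≢n′) β α)
             (does-⇔ (mk⇔ sym sym) (slot x q (left a t) ≟ slot x q (right c t′))
                                   (slot x q (right c t′) ≟ slot x q (left a t))))

  code-active : ∀ x q n → active q n ≡ true → code x q n ≡ slot x q n
  code-active x q n α rewrite α = refl

  mismatch≤deviant-unless-both-active : ∀ x q n n′ → (active q n ∧ active q n′) ≡ false →
    mismatch (label x q n n′) (does (code x q n ≟ code x q n′)) ≤ deviant x q n n′
  mismatch≤deviant-unless-both-active x q n n′ αβ =
    subst (λ s → mismatch (label x q n n′) s ≤ deviant x q n n′)
          (sym (same-code-unless-both-active x q n n′ αβ))
          (mismatch-unless-both (bitPair n n′) (bit x n n′) (active q n) (active q n′) αβ)

  canonical-mismatch≤deviant : ∀ x q n n′ → n ≢ n′ →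
    mismatch (label x q n n′) (does (code x q n ≟ code x q n′)) ≤ deviant x q n n′
  canonical-mismatch≤deviant x q n n′ n≢n′ = by-activity (active q n) (active q n′) refl refl
    where
    goal = mismatch (label x q n n′) (does (code x q n ≟ code x q n′)) ≤ deviant x q n n′
    by-activity : ∀ a a′ → active q n ≡ a → active q n′ ≡ a′ → goal
    by-activity true  true  α β = ≤-trans (≤-reflexive (trans (cong (λ l → mismatch l s) same) (mismatch-refl s))) z≤n
      where
      s = does (code x q n ≟ code x q n′)
      same : label x q n n′ ≡ s
      same = trans (label≡same-slot x q n n′ n≢n′ α β)
                   (sym (cong₂ (λ m m′ → does (m ≟ m′)) (code-active x q n α) (code-active x q n′ β)))
    by-activity true  false α β = mismatch≤deviant-unless-both-active x q n n′ (cong₂ _∧_ α β)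
    by-activity false _     α _ = mismatch≤deviant-unless-both-active x q n n′ (cong (_∧ active q n′) α)

  bitPair-pad : ∀ n l → bitPair n (pad l) ≡ false
  bitPair-pad (left _ _)  l = refl
  bitPair-pad (right _ _) l = refl
  bitPair-pad (pad _)     l = refl

  𝟙bitPair≤𝟙isRight : ∀ a t n → 𝟙 (bitPair (left a t) n) ≤ 𝟙 (isRight n)
  𝟙bitPair≤𝟙isRight a t (left _ _)  = z≤n
  𝟙bitPair≤𝟙isRight a t (right _ _) = 𝟙≤1 _
  𝟙bitPair≤𝟙isRight a t (pad _)     = z≤n

  𝟙bitPair≤𝟙isLeft : ∀ c t n → 𝟙 (bitPair (right c t) n) ≤ 𝟙 (isLeft n)
  𝟙bitPair≤𝟙isLeft c t (left _ _)  = 𝟙≤1 _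
  𝟙bitPair≤𝟙isLeft c t (right _ _) = z≤n
  𝟙bitPair≤𝟙isLeft c t (pad _)     = z≤n

  bitPartners≤pb : ∀ n → ∑[ j < N ] 𝟙 (bitPair n (node j)) ≤ p * b
  bitPartners≤pb (left a t)  = ≤-trans (∑.mono N (λ j → 𝟙bitPair≤𝟙isRight a t (node j))) (≤-reflexive count-right)
  bitPartners≤pb (right c t) = ≤-trans (∑.mono N (λ j → 𝟙bitPair≤𝟙isLeft c t (node j))) (≤-reflexive count-left)
  bitPartners≤pb (pad l)     = ≤-trans (≤-reflexive (∑.zeros N)) z≤n

  deviant≤1 : ∀ x q n n′ → deviant x q n n′ ≤ 1
  deviant≤1 x q n n′ = ≤-trans (deviation≤𝟙 (bitPair n n′) (bit x n n′) (active q n) (active q n′)) (𝟙≤1 _)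

  -- Deviant pairs are bit pairs, which never involve a pad vertex.
  deviant+padPair≤1 : ∀ x q n n′ → deviant x q n n′ + (𝟙 (not (isPad n)) * 𝟙 (isPad n′) + 𝟙 (not (isPad n′)) * 𝟙 (isPad n)) ≤ 1
  deviant+padPair≤1 x q (pad _)     (pad _)     = z≤n
  deviant+padPair≤1 x q (pad _)     (left _ _)  = ≤-refl
  deviant+padPair≤1 x q (pad _)     (right _ _) = ≤-refl
  deviant+padPair≤1 x q (left _ _)  (pad _)     = ≤-refl
  deviant+padPair≤1 x q (right _ _) (pad _)     = ≤-refl
  deviant+padPair≤1 x q (left a t)  (left _ _)  = z≤n
  deviant+padPair≤1 x q (right c t) (right _ _) = z≤n
  deviant+padPair≤1 x q (left a t)  (right c t′) =
    subst (_≤ 1) (sym (+-identityʳ _)) (deviant≤1 x q (left a t) (right c t′))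
  deviant+padPair≤1 x q (right c t) (left a t′) =
    subst (_≤ 1) (sym (+-identityʳ _)) (deviant≤1 x q (right c t) (left a t′))

  module Analysis (1≤z : 1 ≤ z) (pb≤z : p * b ≤ z) (2b<N : 2 * b < N) where

    code<N : ∀ x q n → code x q n < N
    code<N x q n = ≤-<-trans (code≤2b x q n) 2b<N

    canonical : Input → Query → Clustering N
    canonical x q i = fromℕ< (code<N x q (node i))

    dev : Input → Query → Fin N → Fin N → ℕ
    dev x q i j = deviant x q (node i) (node j)

    deviants : Input → Query → ℕ
    deviants x q = ∑² N (λ i j → upper i j (dev x q i j))

    cost-canonical≤deviants : ∀ x q → cost (hard x q) (canonical x q) ≤ deviants x q
    cost-canonical≤deviants x q = begin
      cost (hard x q) (canonical x q)                                          ≡⟨ cost-as-∑² (hard x q) (canonical x q) ⟩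
      ∑² N (λ i j → upper i j (disagree (hard x q) (canonical x q) (i , j)))
        ≤⟨ ∑²-mono N (λ i j → upper-mono i j (pointwise i j)) ⟩
      deviants x q                                                             ∎
      where
      open ≤-Reasoning
      pointwise : ∀ i j → i ≢ j → disagree (hard x q) (canonical x q) (i , j) ≤ dev x q i j
      pointwise i j i≢j = begin
        disagree (hard x q) (canonical x q) (i , j)                     ≡⟨ disagree≡mismatch (hard x q) (canonical x q) i j ⟩
        mismatch (hard x q i j) (does (canonical x q i ≟ᶠ canonical x q j))
          ≡⟨ cong (mismatch (hard x q i j)) (does-fromℕ<-≟ (code<N x q (node i)) (code<N x q (node j))) ⟩
        mismatch (hard x q i j) (does (code x q (node i) ≟ code x q (node j)))
          ≤⟨ canonical-mismatch≤deviant x q (node i) (node j) (i≢j ∘ node-injective) ⟩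
        dev x q i j                                                     ∎

    module LowerBound (x : Input) (q : Query) (C : Clustering N) where

      d : Fin N → Fin N → ℕ
      d i j = mismatch (hard x q i j) (does (C i ≟ᶠ C j))

      δ : Fin N → Fin N → ℕ
      δ = dev x q

      onPad offPad : Fin N → ℕ
      onPad  i = 𝟙 (isPad (node i))
      offPad i = 𝟙 (not (isPad (node i)))

      padPair : Fin N → Fin N → ℕ
      padPair i j = offPad i * onPad j + offPad j * onPad i

      deviantCost padCost : ℕ
      deviantCost = ∑² N (λ i j → δ i j * d i j)
      padCost     = ∑² N (λ i j → padPair i j * d i j)

      d-sym : ∀ i j → d i j ≡ d j i
      d-sym i j = cong₂ mismatch (label-sym x q (node i) (node j)) (does-⇔ (mk⇔ sym sym) (C i ≟ᶠ C j) (C j ≟ᶠ C i))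

      δ-sym : ∀ i j → δ i j ≡ δ j i
      δ-sym i j = deviant-sym x q (node i) (node j)

      degree : ∀ i → ∑[ j < N ] δ i j ≤ z * offPad i
      degree i = degree-node (node i)
        where
        open ≤-Reasoning
        bounded : ∀ n → ∑[ j < N ] deviant x q n (node j) ≤ z * 1
        bounded n = begin
          ∑[ j < N ] deviant x q n (node j)
            ≤⟨ ∑.mono N (λ j → deviation≤𝟙 (bitPair n (node j)) (bit x n (node j)) (active q n) (active q (node j))) ⟩
          ∑[ j < N ] 𝟙 (bitPair n (node j))  ≤⟨ bitPartners≤pb n ⟩
          p * b                              ≤⟨ pb≤z ⟩
          z                                  ≡⟨ *-identityʳ z ⟨
          z * 1                              ∎
        degree-node : ∀ n → ∑[ j < N ] deviant x q n (node j) ≤ z * 𝟙 (not (isPad n))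
        degree-node (left a t)  = bounded (left a t)
        degree-node (right c t) = bounded (right c t)
        degree-node (pad l)     = ≤-reflexive (trans (∑.zeros N) (sym (*-zeroʳ z)))

      pad-triangle : ∀ i j y l → node y ≡ pad l → δ i j ≡ 1 → 1 ≤ d i j + d i y + d j y
      pad-triangle i j y l y≡pad δ≡1 =
        subst₂ (λ lᵢ lⱼ → 1 ≤ d i j + mismatch lᵢ (does (C i ≟ᶠ C y)) + mismatch lⱼ (does (C j ≟ᶠ C y)))
               (sym (label-pad i)) (sym (label-pad j))
               (OneMinus-disagrees (C i) (C j) (C y)
                 (deviation-OneMinus (bitPair (node i) (node j)) (bit x (node i) (node j))
                                     (active q (node i)) (active q (node j)) δ≡1))
        where
        label-pad : ∀ i → hard x q i y ≡ not (active q (node i) ∨ false)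
        label-pad i rewrite y≡pad | bitPair-pad (node i) l = refl

      triangle : ∀ i j y → δ i j * onPad y ≤ δ i j * onPad y * (d i j + d i y + d j y)
      triangle i j y = m≤1⇒m≤m*n (δ i j * onPad y) _
        (*-mono-≤ (deviant≤1 x q (node i) (node j)) (𝟙≤1 (isPad (node y))))
        (λ e → on-pad (node y) refl (m*n≡1⇒m≡1 (δ i j) (onPad y) e) (m*n≡1⇒n≡1 (δ i j) (onPad y) e))
        where
        on-pad : ∀ n → node y ≡ n → δ i j ≡ 1 → 𝟙 (isPad n) ≡ 1 → 1 ≤ d i j + d i y + d j y
        on-pad (pad l) y≡pad δ≡1 _ = pad-triangle i j y l y≡pad δ≡1
        on-pad (left _ _)  _ _ ()
        on-pad (right _ _) _ _ ()

      padDisagreements viaFirst viaSecond : ℕ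
      padDisagreements = ∑² N (λ i y → offPad i * (onPad y * d i y))
      viaFirst  = ∑² N (λ i j → ∑[ y < N ] (δ i j * onPad y * d i y))
      viaSecond = ∑² N (λ i j → ∑[ y < N ] (δ i j * onPad y * d j y))

      viaSecond≡viaFirst : viaSecond ≡ viaFirst
      viaSecond≡viaFirst = trans
        (∑²-cong N (λ i j → ∑.cong-≗ N (λ y → cong (λ e → e * onPad y * d j y) (δ-sym i j))))
        (∑²-transpose N (λ i j → ∑[ y < N ] (δ i j * onPad y * d i y)))

      viaFirst≤ : viaFirst ≤ z * padDisagreements
      viaFirst≤ = begin
        viaFirst
          ≡⟨ ∑.cong-≗ N (λ i → ∑-comm (λ j y → δ i j * onPad y * d i y)) ⟩
        ∑² N (λ i y → ∑[ j < N ] (δ i j * onPad y * d i y))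
          ≡⟨ ∑²-cong N (λ i y → trans (∑.cong-≗ N (λ j → *-assoc (δ i j) (onPad y) (d i y)))
                                      (∑.*-distribʳ N (onPad y * d i y) (δ i))) ⟩
        ∑² N (λ i y → (∑[ j < N ] δ i j) * (onPad y * d i y))
          ≤⟨ ∑²-mono N (λ i y → *-monoˡ-≤ (onPad y * d i y) (degree i)) ⟩
        ∑² N (λ i y → z * offPad i * (onPad y * d i y))    ≡⟨ ∑²-cong N (λ i y → *-assoc z (offPad i) _) ⟩
        ∑² N (λ i y → z * (offPad i * (onPad y * d i y)))  ≡⟨ ∑²-*ˡ N z _ ⟩
        z * padDisagreements                               ∎
        where open ≤-Reasoning

      padCost≡ : padCost ≡ padDisagreements + padDisagreements
      padCost≡ = begin
        ∑² N (λ i j → padPair i j * d i j)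
          ≡⟨ ∑²-cong N (λ i j → trans (*-distribʳ-+ (d i j) (offPad i * onPad j) (offPad j * onPad i))
                                      (cong₂ _+_ (*-assoc (offPad i) (onPad j) (d i j)) (*-assoc (offPad j) (onPad i) (d i j)))) ⟩
        ∑² N (λ i j → offPad i * (onPad j * d i j) + offPad j * (onPad i * d i j))
          ≡⟨ ∑²-distrib-+ N _ _ ⟩
        padDisagreements + ∑² N (λ i j → offPad j * (onPad i * d i j))
          ≡⟨ cong (padDisagreements +_) (trans (∑²-cong N (λ i j → cong (λ e → offPad j * (onPad i * e)) (d-sym i j)))
                                               (∑²-transpose N (λ i y → offPad i * (onPad y * d i y)))) ⟩
        padDisagreements + padDisagreements                              ∎
        where open ≡-Reasoning

      expand-triangle : ∀ i j → ∑[ y < N ] (δ i j * onPad y * (d i j + d i y + d j y)) ≡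
        ∑[ y < N ] (δ i j * onPad y * d i j) + (∑[ y < N ] (δ i j * onPad y * d i y) + ∑[ y < N ] (δ i j * onPad y * d j y))
      expand-triangle i j = trans (∑.cong-≗ N (λ y → distrib₃ (δ i j * onPad y) (d i j) (d i y) (d j y)))
        (trans (∑.distrib-+ N (λ y → δ i j * onPad y * d i j) _)
               (cong (∑[ y < N ] (δ i j * onPad y * d i j) +_)
                     (∑.distrib-+ N (λ y → δ i j * onPad y * d i y) (λ y → δ i j * onPad y * d j y))))
        where
        distrib₃ : ∀ w a b c → w * (a + b + c) ≡ w * a + (w * b + w * c)
        distrib₃ w a b c = trans (*-distribˡ-+ w (a + b) c)
          (trans (cong (_+ w * c) (*-distribˡ-+ w a b)) (+-assoc (w * a) (w * b) (w * c)))

      ∑-onPad : ∀ e a → ∑[ y < N ] (e * onPad y * a) ≡ e * a * z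
      ∑-onPad e a = begin
        ∑[ y < N ] (e * onPad y * a)  ≡⟨ ∑.*-distribʳ N a (λ y → e * onPad y) ⟩
        ∑[ y < N ] (e * onPad y) * a  ≡⟨ cong (_* a) (trans (∑.*-distribˡ N e onPad) (cong (e *_) count-pad)) ⟩
        e * z * a                     ≡⟨ x*y*z≡x*z*y e z a ⟩
        e * a * z                     ∎
        where open ≡-Reasoning

      -- Each deviant pair forms a triangle with one negative edge with each of the z pad
      -- vertices; a pad edge is used by at most z deviant pairs since the degree is ≤ pb ≤ z.
      charge : ∑² N δ * z ≤ (deviantCost + padCost) * z
      charge = begin
        ∑² N δ * z                                                  ≡⟨ ∑²-*ʳ N δ z ⟨
        ∑² N (λ i j → δ i j * z)
          ≡⟨ ∑²-cong N (λ i j → trans (cong (δ i j *_) (sym count-pad)) (sym (∑.*-distribˡ N (δ i j) onPad))) ⟩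
        ∑² N (λ i j → ∑[ y < N ] (δ i j * onPad y))                  ≤⟨ ∑²-mono N (λ i j → ∑.mono N (triangle i j)) ⟩
        ∑² N (λ i j → ∑[ y < N ] (δ i j * onPad y * (d i j + d i y + d j y)))
          ≡⟨ ∑²-cong N expand-triangle ⟩
        ∑² N (λ i j → ∑[ y < N ] (δ i j * onPad y * d i j)
                      + (∑[ y < N ] (δ i j * onPad y * d i y) + ∑[ y < N ] (δ i j * onPad y * d j y)))
          ≡⟨ trans (∑²-distrib-+ N (λ i j → ∑[ y < N ] (δ i j * onPad y * d i j)) _)
                   (cong (direct +_) (∑²-distrib-+ N (λ i j → ∑[ y < N ] (δ i j * onPad y * d i y))
                                                (λ i j → ∑[ y < N ] (δ i j * onPad y * d j y)))) ⟩
        direct + (viaFirst + viaSecond)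
          ≡⟨ cong₂ _+_ (trans (∑²-cong N (λ i j → ∑-onPad (δ i j) (d i j))) (∑²-*ʳ N _ z))
                       (cong (viaFirst +_) viaSecond≡viaFirst) ⟩
        deviantCost * z + (viaFirst + viaFirst)
          ≤⟨ +-monoʳ-≤ (deviantCost * z) (+-mono-≤ viaFirst≤ viaFirst≤) ⟩
        deviantCost * z + (z * padDisagreements + z * padDisagreements)
          ≡⟨ cong (deviantCost * z +_) (trans (sym (*-distribˡ-+ z padDisagreements padDisagreements))
                                              (trans (*-comm z _) (cong (_* z) (sym padCost≡)))) ⟩
        deviantCost * z + padCost * z                               ≡⟨ *-distribʳ-+ z deviantCost padCost ⟨
        (deviantCost + padCost) * z                                 ∎
        where
        open ≤-Reasoning
        direct = ∑² N (λ i j → ∑[ y < N ] (δ i j * onPad y * d i j))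

      padPair-irrefl : ∀ i → padPair i i ≡ 0
      padPair-irrefl i = cong (λ e → e + e) (not-e*e (isPad (node i)))
        where
        not-e*e : ∀ e → 𝟙 (not e) * 𝟙 e ≡ 0
        not-e*e true  = refl
        not-e*e false = refl

      deviants≤ : deviants x q ≤ ∑² N (λ i j → upper i j ((δ i j + padPair i j) * d i j))
      deviants≤ = *-cancelˡ-≤ 2 (begin
        2 * deviants x q                              ≡⟨ ∑²≡2*upper N δ δ-sym (λ i → deviant-irrefl x q (node i)) ⟨
        ∑² N δ
          ≤⟨ *-cancelʳ-≤ _ _ z {{>-nonZero 1≤z}} (≤-trans charge (≤-reflexive (cong (_* z) split))) ⟩
        ∑² N (λ i j → (δ i j + padPair i j) * d i j)  ≡⟨ ∑²≡2*upper N _ symmetric irreflexive ⟩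
        2 * ∑² N (λ i j → upper i j ((δ i j + padPair i j) * d i j)) ∎)
        where
        open ≤-Reasoning
        split : deviantCost + padCost ≡ ∑² N (λ i j → (δ i j + padPair i j) * d i j)
        split = trans (sym (∑²-distrib-+ N _ _)) (∑²-cong N (λ i j → sym (*-distribʳ-+ (d i j) (δ i j) (padPair i j))))
        symmetric : ∀ i j → (δ i j + padPair i j) * d i j ≡ (δ j i + padPair j i) * d j i
        symmetric i j = cong₂ _*_ (cong₂ _+_ (δ-sym i j) (+-comm (offPad i * onPad j) _)) (d-sym i j)
        irreflexive : ∀ i → (δ i i + padPair i i) * d i i ≡ 0
        irreflexive i = cong (_* d i i) (cong₂ _+_ (deviant-irrefl x q (node i)) (padPair-irrefl i))

      module QueryPair (t : Fin b) where

        u₀ v₀ : Fin N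
        u₀ = vertex (left (qˡ q) t)
        v₀ = vertex (right (qʳ q) t)

        marked : Fin N → Fin N → ℕ
        marked i j = 𝟙 (does (i ≟ᶠ u₀) ∧ does (j ≟ᶠ v₀))

        unmarked : ∀ i j → δ i j + padPair i j + 0 ≤ 1
        unmarked i j = subst (_≤ 1) (sym (+-identityʳ _)) (deviant+padPair≤1 x q (node i) (node j))

        exclusive : ∀ i j → δ i j + padPair i j + marked i j ≤ 1
        exclusive i j with i ≟ᶠ u₀ | j ≟ᶠ v₀
        ... | yes refl | yes refl rewrite node-vertex (left (qˡ q) t) | node-vertex (right (qʳ q) t)
          | dec-true (t ≟ᶠ t) refl | dec-true (qˡ q ≟ᶠ qˡ q) refl | dec-true (qʳ q ≟ᶠ qʳ q) refl = ≤-refl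
        ... | yes _ | no  _ = unmarked i j
        ... | no  _ | _     = unmarked i j

        u₀<v₀ : toℕ u₀ < toℕ v₀
        u₀<v₀ = begin-strict
          toℕ u₀                                      ≡⟨ toℕ-↑ˡ (combine (qˡ q) t) (p * b + z) ⟩
          toℕ (combine {p} {b} (qˡ q) t)              <⟨ toℕ<n (combine {p} {b} (qˡ q) t) ⟩
          p * b                                       ≤⟨ m≤m+n (p * b) _ ⟩
          p * b + toℕ (combine {p} {b} (qʳ q) t ↑ˡ z)  ≡⟨ toℕ-↑ʳ (p * b) (combine (qʳ q) t ↑ˡ z) ⟨
          toℕ v₀                                      ∎
          where open ≤-Reasoning

        query-pair≤ : d u₀ v₀ ≤ ∑² N (λ i j → upper i j (marked i j * d i j))
        query-pair≤ = ≤-trans (≤-reflexive (sym marked-value)) (term≤∑² N (λ i j → upper i j (marked i j * d i j)) u₀ v₀)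
          where
          marked-value : upper u₀ v₀ (marked u₀ v₀ * d u₀ v₀) ≡ d u₀ v₀
          marked-value rewrite dec-true (toℕ u₀ <? toℕ v₀) u₀<v₀ | dec-true (u₀ ≟ᶠ u₀) refl | dec-true (v₀ ≟ᶠ v₀) refl =
            +-identityʳ (d u₀ v₀)

        deviants+query≤cost : deviants x q + d u₀ v₀ ≤ cost (hard x q) C
        deviants+query≤cost = begin
          deviants x q + d u₀ v₀
            ≤⟨ +-mono-≤ deviants≤ query-pair≤ ⟩
          ∑² N (λ i j → upper i j ((δ i j + padPair i j) * d i j)) + ∑² N (λ i j → upper i j (marked i j * d i j))
            ≡⟨ ∑²-distrib-+ N (λ i j → upper i j ((δ i j + padPair i j) * d i j)) (λ i j → upper i j (marked i j * d i j)) ⟨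
          ∑² N (λ i j → upper i j ((δ i j + padPair i j) * d i j) + upper i j (marked i j * d i j))
            ≡⟨ ∑²-cong N (λ i j → upper-distrib-+ i j ((δ i j + padPair i j) * d i j) (marked i j * d i j)) ⟨
          ∑² N (λ i j → upper i j ((δ i j + padPair i j) * d i j + marked i j * d i j))
            ≤⟨ ∑²-mono N (λ i j → upper-mono i j (λ _ → weighted≤d i j)) ⟩
          ∑² N (λ i j → upper i j (d i j))
            ≡⟨ ∑²-cong N (λ i j → cong (upper i j) (disagree≡mismatch (hard x q) C i j)) ⟨
          ∑² N (λ i j → upper i j (disagree (hard x q) C (i , j)))
            ≡⟨ cost-as-∑² (hard x q) C ⟨
          cost (hard x q) C ∎
          where
          open ≤-Reasoning
          weighted≤d : ∀ i j → (δ i j + padPair i j) * d i j + marked i j * d i j ≤ d i j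
          weighted≤d i j = begin
            (δ i j + padPair i j) * d i j + marked i j * d i j ≡⟨ *-distribʳ-+ (d i j) (δ i j + padPair i j) (marked i j) ⟨
            (δ i j + padPair i j + marked i j) * d i j         ≤⟨ *-monoˡ-≤ (d i j) (exclusive i j) ⟩
            1 * d i j                                         ≡⟨ *-identityˡ (d i j) ⟩
            d i j                                             ∎

    optimal-decodes : ∀ x q C → Optimal (hard x q) C → ∀ t →
      does (C (vertex (left (qˡ q) t)) ≟ᶠ C (vertex (right (qʳ q) t))) ≡ lookup (x q) t
    optimal-decodes x q C optimal t = trans (sym (mismatch≡0⇒≡ _ _ no-mismatch)) label≡bit
      where
      open LowerBound x q C
      open QueryPair t
      no-mismatch : d u₀ v₀ ≡ 0
      no-mismatch = n≤0⇒n≡0 (+-cancelˡ-≤ (deviants x q) _ 0 (begin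
        deviants x q + d u₀ v₀           ≤⟨ deviants+query≤cost ⟩
        cost (hard x q) C                ≤⟨ optimal (canonical x q) ⟩
        cost (hard x q) (canonical x q)  ≤⟨ cost-canonical≤deviants x q ⟩
        deviants x q                     ≡⟨ +-identityʳ (deviants x q) ⟨
        deviants x q + 0                 ∎))
        where open ≤-Reasoning
      label≡bit : hard x q u₀ v₀ ≡ lookup (x q) t
      label≡bit rewrite node-vertex (left (qˡ q) t) | node-vertex (right (qʳ q) t) | dec-true (t ≟ᶠ t) refl =
        cong (λ r → lookup (x r) t) (combine-remQuot {p} p q)

    bits : Input → Labeling N
    bits x i j = bit x (node i) (node j)

    inactive : Query → Labeling N
    inactive q i j = not (active q (node i) ∨ active q (node j))

    isBitPair : Fin N × Fin N → Bool
    isBitPair (i , j) = bitPair (node i) (node j)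

    bitPairs+others : List (Fin N × Fin N) × List (Fin N × Fin N)
    bitPairs+others = partition (T? ∘ isBitPair) (allPairs N)

    -- Bit pairs first: their labels depend only on the input, the others only on the query.
    order : List (Fin N × Fin N)
    order = proj₁ bitPairs+others List.++ proj₂ bitPairs+others

    order↭ : order ↭ allPairs N
    order↭ = ↭-sym (↭ₛ⇒↭ (Perm.partition-↭ (setoid (Fin N × Fin N)) (T? ∘ isBitPair) (allPairs N)))

    stream-order : ∀ x q → stream (hard x q) order ≡
      stream (bits x) (proj₁ bitPairs+others) List.++ stream (inactive q) (proj₂ bitPairs+others)
    stream-order x q = trans (List.map-++ _ (proj₁ bitPairs+others) _) (cong₂ List._++_
      (List.map-cong-local (All.map on-bitPair (proj₁ (partition-All (T? ∘ isBitPair) (allPairs N)))))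
      (List.map-cong-local (All.map on-other (proj₂ (partition-All (T? ∘ isBitPair) (allPairs N))))))
      where
      entry : Labeling N → Fin N × Fin N → Edge N
      entry L (i , j) = i , j , L i j
      on-bitPair : ∀ {e} → T (isBitPair e) → entry (hard x q) e ≡ entry (bits x) e
      on-bitPair {i , j} isBit = cong (λ l → i , j , l) (if-T isBit)
      on-other : ∀ {e} → ¬ T (isBitPair e) → entry (hard x q) e ≡ entry (inactive q) e
      on-other {i , j} notBit = cong (λ l → i , j , l) (if-¬T notBit)

    module Protocol {s m} (A : StreamAlg N s m) (solves : Solves A) where

      memory : Fin m → Input → Vec Bool s
      memory r x = runList (step A r) (init A r) (stream (bits x) (proj₁ bitPairs+others))

      answer : Fin m → Vec Bool s → Query → Clustering N
      answer r M q = out A r (runList (step A r) M (stream (inactive q) (proj₂ bitPairs+others)))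

      run≡answer : ∀ r x q → run A r (stream (hard x q) order) ≡ answer r (memory r x) q
      run≡answer r x q = cong (out A r) (trans (cong (runList (step A r) (init A r)) (stream-order x q))
        (runList-++ (step A r) (init A r) (stream (bits x) (proj₁ bitPairs+others)) _))

      decode : Fin m → Vec Bool s → Query → Vec Bool b
      decode r M q = tabulate (λ t → does (answer r M q (vertex (left (qˡ q) t)) ≟ᶠ answer r M q (vertex (right (qʳ q) t))))

      good-seeds : Input → Query → Subset m
      good-seeds x q = proj₁ (solves (hard x q) order order↭)

      good⇒decodes : ∀ r x q → 𝟙 (lookup (good-seeds x q) r) ≤ 𝟙 (does (decode r (memory r x) q ≟ᵛ x q))
      good⇒decodes r x q with lookup (good-seeds x q) r in r∈G
      ... | false = z≤n
      ... | true  = ≤-reflexive (sym (cong 𝟙 (dec-true (decode r (memory r x) q ≟ᵛ x q) decodes)))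
        where
        optimal : Optimal (hard x q) (answer r (memory r x) q)
        optimal = subst (Optimal (hard x q)) (run≡answer r x q)
                        (proj₂ (proj₂ (solves (hard x q) order order↭)) r (lookup⇒[]= r (good-seeds x q) r∈G))
        decodes : decode r (memory r x) q ≡ x q
        decodes = trans (tabulate-cong (optimal-decodes x q (answer r (memory r x) q) optimal)) (tabulate∘lookup (x q))

      majority : ∀ x q → 2 * m < 3 * ∑[ r < m ] 𝟙 (lookup (good-seeds x q) r)
      majority x q = subst (λ c → 2 * m < 3 * c) (∣∣≡∑𝟙 (good-seeds x q))
                           (proj₁ (proj₂ (solves (hard x q) order order↭)))

      #inputs≥1 : 1 ≤ ∑ᵇ (p * p) b (λ _ → 1)
      #inputs≥1 = subst (1 ≤_) (sym (∑ᵇ-count (p * p) b)) (m^n>0 (2 ^ b) {{m^n≢0 2 b}} (p * p))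

      some-seed : 1 ≤ p * p → ∃ λ r →
        2 * (p * p) * ∑ᵇ (p * p) b (λ _ → 1) < 3 * ∑ᵇ (p * p) b (λ x → ∑[ q < p * p ] 𝟙 (lookup (good-seeds x q) r))
      some-seed 1≤k = averaging (∑ᵇ-isSummation (p * p) b) (p * p) m (λ x q r → 𝟙 (lookup (good-seeds x q) r))
                                majority 1≤k #inputs≥1

      good⇒agreement : ∀ r → ∑ᵇ (p * p) b (λ x → ∑[ q < p * p ] 𝟙 (lookup (good-seeds x q) r))
                           ≤ ∑ᵇ (p * p) b (λ x → agreement x (decode r (memory r x)))
      good⇒agreement r = ∑ᵇ.mono (p * p) b (λ x → ∑.mono (p * p) (λ q → good⇒decodes r x q))

      streaming-bound : ∀ K → 3 * K ≤ p * p → 1 ≤ p * p → b * K ≤ s + p * p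
      streaming-bound K 3K≤k 1≤k =
        let r , many = some-seed 1≤k in
        one-way-bound K (memory r) (decode r) 3K≤k (<-≤-trans many (*-monoʳ-≤ 3 (good⇒agreement r)))

-- p = 3(a+1) makes p² divisible by 3, b = 4 > 3 makes b·p²/3 − p² positive, and the
-- z = pb + r pads satisfy pb ≤ z.
hard-size : ℕ → ℕ → ℕ
hard-size a r = HardInstance.N (3 * suc a) 4 (12 * suc a + r)

hard-size≡ : ∀ a r → hard-size a r ≡ r + suc a * 36
hard-size≡ a r = rearrange (suc a) r
  where
  rearrange : ∀ a r → 3 * a * 4 + (3 * a * 4 + (12 * a + r)) ≡ r + a * 36
  rearrange = solve-∀

hard-size-surjective : ∀ n → 36 ≤ n → ∃ λ a → ∃ λ r → r < 36 × hard-size a r ≡ n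
hard-size-surjective n 36≤n with n / 36 in n/36≡
... | zero  = ⊥-elim (<-irrefl (sym n/36≡) (m≥n⇒m/n>0 36≤n))
... | suc a = a , n % 36 , m%n<n n 36 ,
  trans (hard-size≡ a (n % 36)) (sym (trans (m≡m%n+[m/n]*n n 36) (cong (λ c → n % 36 + c * 36) n/36≡)))

streaming-lower-bound : ∀ a r {s m} (A : StreamAlg (hard-size a r) s m) → Solves A → 3 * (suc a * suc a) ≤ s
streaming-lower-bound a r {s} A solves =
  +-cancelʳ-≤ (3 * K) K s (subst (λ k → 4 * K ≤ s + k) k≡3K (streaming-bound K (≤-reflexive (sym k≡3K)) 1≤k))
  where
  open HardInstance (3 * suc a) 4 (12 * suc a + r)
  pb≡ : 3 * suc a * 4 ≡ 12 * suc a
  pb≡ = rearrange (suc a)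
    where
    rearrange : ∀ a → 3 * a * 4 ≡ 12 * a
    rearrange = solve-∀
  9≤N : 9 ≤ N
  9≤N = ≤-trans (m≤n+m 9 3) (≤-trans (m≤m*n 12 (suc a)) (≤-trans (≤-reflexive (sym pb≡)) (m≤m+n _ _)))
  open Analysis (s≤s z≤n) (≤-trans (≤-reflexive pb≡) (m≤m+n (12 * suc a) r)) 9≤N
  open Protocol A solves
  K = 3 * (suc a * suc a)
  k≡3K : 3 * suc a * (3 * suc a) ≡ 3 * K
  k≡3K = rearrange (suc a)
    where
    rearrange : ∀ a → 3 * a * (3 * a) ≡ 3 * (3 * (a * a))
    rearrange = solve-∀
  1≤k : 1 ≤ 3 * suc a * (3 * suc a)
  1≤k = ≤-trans (s≤s z≤n) (m≤m*n (3 * suc a) (3 * suc a))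

hard-size≤ : ∀ a r → r < 36 → hard-size a r ≤ 72 * suc a
hard-size≤ a r r<36 = begin
  hard-size a r            ≡⟨ hard-size≡ a r ⟩
  r + suc a * 36           ≤⟨ +-monoˡ-≤ (suc a * 36) (≤-trans (<⇒≤ r<36) (m≤n*m 36 (suc a))) ⟩
  suc a * 36 + suc a * 36  ≡⟨ rearrange (suc a) ⟩
  72 * suc a               ∎
  where
  open ≤-Reasoning
  rearrange : ∀ a → a * 36 + a * 36 ≡ 72 * a
  rearrange = solve-∀

proposition1 : Σ ℕ λ c → Σ ℕ λ N → (0 < c) ×
    (∀ (n s m : ℕ) → N ≤ n → (A : StreamAlg n s m) → Solves A → n * n ≤ c * s)
proposition1 = 1728 , 36 , s≤s z≤n , bound
  where
  bound : ∀ (n s m : ℕ) → 36 ≤ n → (A : StreamAlg n s m) → Solves A → n * n ≤ 1728 * s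
  bound n s m 36≤n A solves with a , r , r<36 , refl ← hard-size-surjective n 36≤n = begin
    hard-size a r * hard-size a r  ≤⟨ *-mono-≤ (hard-size≤ a r r<36) (hard-size≤ a r r<36) ⟩
    (72 * suc a) * (72 * suc a)    ≡⟨ rearrange (suc a) ⟩
    1728 * (3 * (suc a * suc a))   ≤⟨ *-monoʳ-≤ 1728 (streaming-lower-bound a r A solves) ⟩
    1728 * s                       ∎
    where
    open ≤-Reasoning
    rearrange : ∀ a → (72 * a) * (72 * a) ≡ 1728 * (3 * (a * a))
    rearrange = solve-∀
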